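{- Let $a,b\geq 1$ be integers with $d=a+b+1$ prime. For card deals of size $(a,b,1)$, Alice's announcement of $\sum_d A$ is secure if and only if $a>2$ and $b>2$.
   Context: Cards are the integers $0,\dots,d-1$, $D=\{0,\dots,d-1\}$. A deal of size $(a,b,c)$ is a triple $(A,B,C)$ of pairwise disjoint subsets of $D$ of sizes $a,b,c$ held by Alice, Bob and Cath respectively; initially each player knows only her own hand. For $X\subseteq D$, $\sum_d X$ is the sum of the elements of $X$ in $\mathbb Z/(d)$. Announcing $\sum_d A$ is secure for deals of size $(a,b,c)$ if for every deal $(A,B,C)$ of that size and every card $z\notin C$ there exist deals $(A',B',C)$ and $(A'',B'',C)$ of that size with $\sum_d A'=\sum_d A''=\sum_d A$, $z\notin A'$ and $z\notin B''$; i.e. after the announcement Cath does not know of any card that Alice holds it nor of any card that Bob holds it. -}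

module Defs where

open import Data.Nat using (ℕ; zero; suc; _+_; _%_; NonZero)
open import Data.Bool using (Bool; true; false)
open import Data.Fin using (Fin; toℕ)
open import Data.Fin.Subset using (Subset; _∈_; _∉_; ∣_∣)
open import Data.Vec using (Vec; []; _∷_)
open import Data.Product using (Σ; _×_; ∃₂)
open import Relation.Binary.PropositionalEquality using (_≡_)

sumFrom : ∀ {n} → ℕ → Vec Bool n → ℕ
sumFrom k [] = 0
sumFrom k (true ∷ xs) = k + sumFrom (suc k) xs
sumFrom k (false ∷ xs) = sumFrom (suc k) xs

sumℕ : ∀ {n} → Subset n → ℕ
sumℕ X = sumFrom 0 X

-- Σ_d X : the sum of the elements of X, taken in ℤ/(d), represented by
-- its canonical residue in {0,…,d-1}.
Σd : ∀ {d} .{{_ : NonZero d}} → Subset d → ℕ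
Σd {d} X = sumℕ X % d

Disjoint : ∀ {n} → Subset n → Subset n → Set
Disjoint X Y = ∀ x → x ∈ X → x ∉ Y

IsDeal : ∀ {d} → ℕ → ℕ → ℕ → Subset d → Subset d → Subset d → Set
IsDeal a b c A B C =
  Disjoint A B × Disjoint A C × Disjoint B C ×
  ∣ A ∣ ≡ a × ∣ B ∣ ≡ b × ∣ C ∣ ≡ c

SumAnnouncementSecure : (d : ℕ) .{{_ : NonZero d}} → ℕ → ℕ → ℕ → Set
SumAnnouncementSecure d a b c =
  ∀ (A B C : Subset d) → IsDeal a b c A B C →
  ∀ (z : Fin d) → z ∉ C →
    (∃₂ λ (A′ B′ : Subset d) → IsDeal a b c A′ B′ C × Σd A′ ≡ Σd A × z ∉ A′)
  × (∃₂ λ (A″ B″ : Subset d) → IsDeal a b c A″ B″ C × Σd A″ ≡ Σd A × z ∉ B″)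

module Submission where

-- Cath holds one card c, so every other card is Alice's or Bob's, and since the total of all cards
-- is known, Σd A also reveals Σd B: Alice and Bob play symmetric roles. If a ∈ {1, 2} Cath can
-- learn a card: with C = {0}, the only one-card hand of sum 1 is {1}, and a two-card hand of sum 3
-- containing 3 would need the card 0. Conversely, for d prime the affine bijection i ↦ c + (z − c) i
-- of ℤ/d sends 0 to c and 1 to z and moves sums of k-element sets affinely, so it suffices that
-- k-element subsets of {2, …, d − 1} take every residue as their sum, for k = a (a hand avoiding z)
-- and k = a − 1 (joined by 1, a hand containing z). Sets formed by two runs of consecutive integers
-- already realise k (d − 2 − k) + 1 consecutive sums, which is at least d once a, b ≥ 3.

import Algebra.Properties.CommutativeSemigroup as CommutativeSemigroupProperties
open import Data.Bool using (true; false)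
open import Data.Empty using (⊥-elim)
open import Data.Fin using (Fin; zero; suc; toℕ)
open import Data.Fin.Properties using (toℕ<n; toℕ-injective; toℕ-fromℕ<)
open import Data.Fin.Subset using (Subset; _∈_; _∉_; ∣_∣; ⊥; ⊤; ⁅_⁆; _∪_; _─_; _-_; ∁; Nonempty)
open import Data.Fin.Subset.Properties
  using (∉⊥; ∈⊤; x∈⁅x⁆; x∈⁅y⁆⇒x≡y; x≢y⇒x∉⁅y⁆; x∈p∪q⁻; x∈p∪q⁺; x∈p⇒x∉∁p; x∈∁p⇒x∉p;
         ∣⊥∣≡0; ∣⁅x⁆∣≡1; ∣p∣≡n⇒p≡⊤; ∣∁p∣≡n∸∣p∣; ∪-identityˡ; ∪-identityʳ; p─⊥≡p; p─q⊆p;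
         Empty-unique; nonempty?; x∈p⇒∣p-x∣<∣p∣)
open import Data.List using (List; []; _∷_; foldr; iterate; length; map)
open import Data.List.Properties using (length-iterate; length-map)
open import Data.List.Membership.Propositional using () renaming (_∈_ to _∈ₗ_)
open import Data.List.Membership.Propositional.Properties using (∈-map⁻)
open import Data.List.Relation.Unary.All using (All; []; _∷_)
import Data.List.Relation.Unary.All as All
import Data.List.Relation.Unary.All.Properties as All
open import Data.List.Relation.Unary.AllPairs using (AllPairs; []; _∷_)
import Data.List.Relation.Unary.AllPairs as AllPairs
import Data.List.Relation.Unary.Any as Any
open import Data.List.Relation.Unary.Unique.Propositional using (Unique)
open import Data.List.Relation.Unary.Unique.Propositional.Properties using (Unique[x∷xs]⇒x∉xs)
open import Data.Nat
  using (ℕ; zero; suc; _+_; _*_; _∸_; _%_; _≤_; _<_; _≤?_; z≤n; s≤s; z<s; s≤s⁻¹;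
         NonZero; ≢-nonZero; nonTrivial⇒n>1)
open import Data.Nat.Coprimality using (prime⇒coprime; coprime-Bézout)
open import Data.Nat.DivMod
  using (_mod_; m%n<n; %-distribˡ-+; %-distribˡ-*; m%n%n≡m%n; [m+kn]%n≡m%n; m<n⇒m%n≡m)
open import Data.Nat.GCD using (module Bézout)
open import Data.Nat.ListAction using (sum)
open import Data.Nat.Primality using (Prime; prime⇒nonTrivial)
open import Data.Nat.Properties
  using (+-commutativeSemigroup; +-assoc; +-comm; +-suc; +-identityʳ; +-cancelʳ-≡; *-comm;
         *-identityˡ; *-identityʳ; *-zeroʳ; suc-injective; n≮0; ≤-refl; ≤-reflexive; ≤-trans; <-irrefl; <⇒≤;
         <⇒≢; ≰⇒≥; m≤m+n; m≤n+m; m<m+n; m≤m*n; +-monoˡ-≤; ∸-monoˡ-≤; m+n∸m≡n; m+n∸n≡m;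
         m∸n+n≡m; m+[n∸m]≡n)
open import Data.Nat.Tactic.RingSolver using (solve-∀)
open import Data.Product using (∃-syntax; ∃₂; _×_; _,_; proj₁; proj₂)
open import Data.Sum using (_⊎_; inj₁; inj₂)
open import Data.Vec using ([]; _∷_; here; there)
open import Function using (_∘_)
open import Function.Bundles using (_⇔_; mk⇔)
open import Level using (0ℓ)
open import Relation.Binary.Bundles using (Setoid)
open import Relation.Binary.PropositionalEquality
import Relation.Binary.Reasoning.Setoid as SetoidReasoning
open import Relation.Binary.Structures using (IsEquivalence)
open import Relation.Nullary using (¬_; yes; no; contradiction)

open import Defs

open CommutativeSemigroupProperties +-commutativeSemigroup using (x∙yz≈y∙xz; x∙yz≈yx∙z; xy∙z≈xz∙y)


-- Sizes and sums of subsets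

sumFrom-⊥ : ∀ {n} k → sumFrom k (⊥ {n}) ≡ 0
sumFrom-⊥ {zero} k = refl
sumFrom-⊥ {suc n} k = sumFrom-⊥ {n} (suc k)

sumFrom-⁅⁆ : ∀ {n} k (x : Fin n) → sumFrom k ⁅ x ⁆ ≡ k + toℕ x
sumFrom-⁅⁆ {suc n} k zero = cong (k +_) (sumFrom-⊥ {n} (suc k))
sumFrom-⁅⁆ k (suc x) = trans (sumFrom-⁅⁆ (suc k) x) (sym (+-suc k (toℕ x)))

Disjoint-tail : ∀ {n} {s t} {X Y : Subset n} → Disjoint (s ∷ X) (t ∷ Y) → Disjoint X Y
Disjoint-tail X#Y x x∈X x∈Y = X#Y (suc x) (there x∈X) (there x∈Y)

Disjoint-sym : ∀ {n} {X Y : Subset n} → Disjoint X Y → Disjoint Y X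
Disjoint-sym X#Y x x∈Y x∈X = X#Y x x∈X x∈Y

Disjoint-∪ : ∀ {n} {X Y Z : Subset n} → Disjoint X Y → Disjoint X Z → Disjoint X (Y ∪ Z)
Disjoint-∪ {Y = Y} X#Y X#Z x x∈X x∈Y∪Z with x∈p∪q⁻ Y _ x∈Y∪Z
... | inj₁ x∈Y = X#Y x x∈X x∈Y
... | inj₂ x∈Z = X#Z x x∈X x∈Z

∉⇒Disjoint-⁅⁆ : ∀ {n} {x : Fin n} {X} → x ∉ X → Disjoint X ⁅ x ⁆
∉⇒Disjoint-⁅⁆ {x = x} {X} x∉X y y∈X y∈⁅x⁆ = x∉X (subst (_∈ X) (x∈⁅y⁆⇒x≡y x y∈⁅x⁆) y∈X)

∣p∪q∣≡∣p∣+∣q∣ : ∀ {n} {X Y : Subset n} → Disjoint X Y → ∣ X ∪ Y ∣ ≡ ∣ X ∣ + ∣ Y ∣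
∣p∪q∣≡∣p∣+∣q∣ {X = []} {[]} _ = refl
∣p∪q∣≡∣p∣+∣q∣ {X = true ∷ X} {true ∷ Y} X#Y = ⊥-elim (X#Y zero here here)
∣p∪q∣≡∣p∣+∣q∣ {X = true ∷ X} {false ∷ Y} X#Y = cong suc (∣p∪q∣≡∣p∣+∣q∣ (Disjoint-tail X#Y))
∣p∪q∣≡∣p∣+∣q∣ {X = false ∷ X} {true ∷ Y} X#Y =
  trans (cong suc (∣p∪q∣≡∣p∣+∣q∣ (Disjoint-tail X#Y))) (sym (+-suc ∣ X ∣ ∣ Y ∣))
∣p∪q∣≡∣p∣+∣q∣ {X = false ∷ X} {false ∷ Y} X#Y = ∣p∪q∣≡∣p∣+∣q∣ (Disjoint-tail X#Y)

sumFrom-∪ : ∀ {n} k {X Y : Subset n} → Disjoint X Y →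
            sumFrom k (X ∪ Y) ≡ sumFrom k X + sumFrom k Y
sumFrom-∪ k {[]} {[]} _ = refl
sumFrom-∪ k {true ∷ X} {true ∷ Y} X#Y = ⊥-elim (X#Y zero here here)
sumFrom-∪ k {true ∷ X} {false ∷ Y} X#Y =
  trans (cong (k +_) (sumFrom-∪ (suc k) (Disjoint-tail X#Y))) (sym (+-assoc k _ _))
sumFrom-∪ k {false ∷ X} {true ∷ Y} X#Y =
  trans (cong (k +_) (sumFrom-∪ (suc k) (Disjoint-tail X#Y))) (x∙yz≈y∙xz k (sumFrom (suc k) X) _)
sumFrom-∪ k {false ∷ X} {false ∷ Y} X#Y = sumFrom-∪ (suc k) (Disjoint-tail X#Y)

sumℕ-⁅⁆ : ∀ {n} (x : Fin n) → sumℕ ⁅ x ⁆ ≡ toℕ x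
sumℕ-⁅⁆ = sumFrom-⁅⁆ 0

x∉p-x : ∀ {n} (p : Subset n) x → x ∉ p - x
x∉p-x (_ ∷ p) zero ()
x∉p-x (_ ∷ p) (suc x) (there x∈p-x) = x∉p-x p x x∈p-x

⁅x⁆∪[p-x]≡p : ∀ {n} {p : Subset n} {x} → x ∈ p → ⁅ x ⁆ ∪ (p - x) ≡ p
⁅x⁆∪[p-x]≡p {p = _ ∷ p} here = cong (true ∷_) (trans (∪-identityˡ (p ─ ⊥)) (p─⊥≡p p))
⁅x⁆∪[p-x]≡p {p = s ∷ p} (there x∈p) = cong (s ∷_) (⁅x⁆∪[p-x]≡p x∈p)

module _ {n} {p : Subset n} {x} (x∈p : x ∈ p) where

  open ≡-Reasoning

  private
    ⁅x⁆#p-x : Disjoint ⁅ x ⁆ (p - x)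
    ⁅x⁆#p-x y y∈⁅x⁆ = subst (_∉ p - x) (sym (x∈⁅y⁆⇒x≡y x y∈⁅x⁆)) (x∉p-x p x)

  ∣p∣≡1+∣p-x∣ : ∣ p ∣ ≡ suc ∣ p - x ∣
  ∣p∣≡1+∣p-x∣ = begin
    ∣ p ∣                    ≡⟨ cong ∣_∣ (⁅x⁆∪[p-x]≡p x∈p) ⟨
    ∣ ⁅ x ⁆ ∪ (p - x) ∣      ≡⟨ ∣p∪q∣≡∣p∣+∣q∣ ⁅x⁆#p-x ⟩
    ∣ ⁅ x ⁆ ∣ + ∣ p - x ∣    ≡⟨ cong (_+ ∣ p - x ∣) (∣⁅x⁆∣≡1 x) ⟩
    suc ∣ p - x ∣            ∎

  sumℕ-p≡x+sumℕ[p-x] : sumℕ p ≡ toℕ x + sumℕ (p - x)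
  sumℕ-p≡x+sumℕ[p-x] = begin
    sumℕ p                       ≡⟨ cong sumℕ (⁅x⁆∪[p-x]≡p x∈p) ⟨
    sumℕ (⁅ x ⁆ ∪ (p - x))       ≡⟨ sumFrom-∪ 0 ⁅x⁆#p-x ⟩
    sumℕ ⁅ x ⁆ + sumℕ (p - x)    ≡⟨ cong (_+ sumℕ (p - x)) (sumℕ-⁅⁆ x) ⟩
    toℕ x + sumℕ (p - x)         ∎

∣p∣≡0⇒p≡⊥ : ∀ {n} {p : Subset n} → ∣ p ∣ ≡ 0 → p ≡ ⊥
∣p∣≡0⇒p≡⊥ {p = p} ∣p∣≡0 = Empty-unique λ (x , x∈p) → n≮0 (subst (∣ p - x ∣ <_) ∣p∣≡0 (x∈p⇒∣p-x∣<∣p∣ x∈p))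

∣p∣≡1+k⇒Nonempty : ∀ {n k} (p : Subset n) → ∣ p ∣ ≡ suc k → Nonempty p
∣p∣≡1+k⇒Nonempty {n} p ∣p∣≡1+k with nonempty? p
... | yes ne = ne
... | no ¬ne = contradiction (trans (sym ∣p∣≡1+k) (trans (cong ∣_∣ (Empty-unique ¬ne)) (∣⊥∣≡0 n))) λ ()

∣p∣≡1⇒p≡⁅x⁆ : ∀ {n} (p : Subset n) → ∣ p ∣ ≡ 1 → ∃[ x ] p ≡ ⁅ x ⁆
∣p∣≡1⇒p≡⁅x⁆ p ∣p∣≡1 with ∣p∣≡1+k⇒Nonempty p ∣p∣≡1
... | x , x∈p = x , (begin
  p                  ≡⟨ ⁅x⁆∪[p-x]≡p x∈p ⟨
  ⁅ x ⁆ ∪ (p - x)    ≡⟨ cong (⁅ x ⁆ ∪_) (∣p∣≡0⇒p≡⊥ (suc-injective (trans (sym (∣p∣≡1+∣p-x∣ x∈p)) ∣p∣≡1))) ⟩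
  ⁅ x ⁆ ∪ ⊥          ≡⟨ ∪-identityʳ ⁅ x ⁆ ⟩
  ⁅ x ⁆              ∎)
  where open ≡-Reasoning

∣p∣≡2⇒sumℕ-pair : ∀ {n} {p : Subset n} {x} → ∣ p ∣ ≡ 2 → x ∈ p →
                  ∃[ y ] y ∈ p × sumℕ p ≡ toℕ x + toℕ y
∣p∣≡2⇒sumℕ-pair {p = p} {x} ∣p∣≡2 x∈p
  with ∣p∣≡1⇒p≡⁅x⁆ (p - x) (suc-injective (trans (sym (∣p∣≡1+∣p-x∣ x∈p)) ∣p∣≡2))
... | y , p-x≡⁅y⁆ =
  y , p─q⊆p p ⁅ x ⁆ (subst (y ∈_) (sym p-x≡⁅y⁆) (x∈⁅x⁆ y)) ,
  trans (sumℕ-p≡x+sumℕ[p-x] x∈p) (cong (toℕ x +_) (trans (cong sumℕ p-x≡⁅y⁆) (sumℕ-⁅⁆ y)))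

fromList : ∀ {n} → List (Fin n) → Subset n
fromList = foldr (λ x X → ⁅ x ⁆ ∪ X) ⊥

∈-fromList⁻ : ∀ {n} {x : Fin n} xs → x ∈ fromList xs → x ∈ₗ xs
∈-fromList⁻ [] x∈⊥ = ⊥-elim (∉⊥ x∈⊥)
∈-fromList⁻ (y ∷ xs) x∈ with x∈p∪q⁻ ⁅ y ⁆ (fromList xs) x∈
... | inj₁ x∈⁅y⁆ = Any.here (x∈⁅y⁆⇒x≡y y x∈⁅y⁆)
... | inj₂ x∈xs = Any.there (∈-fromList⁻ xs x∈xs)

private
  ⁅x⁆#fromList : ∀ {n} {x : Fin n} {xs} → Unique (x ∷ xs) → Disjoint ⁅ x ⁆ (fromList xs)
  ⁅x⁆#fromList {x = x} {xs} x∷xs! y y∈⁅x⁆ y∈xs =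
    Unique[x∷xs]⇒x∉xs x∷xs! (subst (_∈ₗ xs) (x∈⁅y⁆⇒x≡y x y∈⁅x⁆) (∈-fromList⁻ xs y∈xs))

∣fromList∣ : ∀ {n} {xs : List (Fin n)} → Unique xs → ∣ fromList xs ∣ ≡ length xs
∣fromList∣ {n} [] = ∣⊥∣≡0 n
∣fromList∣ {xs = x ∷ xs} x∷xs!@(_ ∷ xs!) =
  trans (∣p∪q∣≡∣p∣+∣q∣ (⁅x⁆#fromList x∷xs!)) (cong₂ _+_ (∣⁅x⁆∣≡1 x) (∣fromList∣ xs!))

sumℕ-fromList : ∀ {n} {xs : List (Fin n)} → Unique xs → sumℕ (fromList xs) ≡ sum (map toℕ xs)
sumℕ-fromList {n} [] = sumFrom-⊥ {n} 0
sumℕ-fromList {xs = x ∷ xs} x∷xs!@(_ ∷ xs!) =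
  trans (sumFrom-∪ 0 (⁅x⁆#fromList x∷xs!)) (cong₂ _+_ (sumℕ-⁅⁆ x) (sumℕ-fromList xs!))

-- Congruence modulo d

module Congruence (d : ℕ) .{{_ : NonZero d}} where

  infix 4 _≈_
  record _≈_ (x y : ℕ) : Set where
    constructor mk≈
    field
      %≡% : x % d ≡ y % d

  open _≈_ public

  ≈-isEquivalence : IsEquivalence _≈_
  ≈-isEquivalence = record
    { refl  = mk≈ refl
    ; sym   = λ x≈y → mk≈ (sym (%≡% x≈y))
    ; trans = λ x≈y y≈z → mk≈ (trans (%≡% x≈y) (%≡% y≈z))
    }

  ≈-setoid : Setoid 0ℓ 0ℓ
  ≈-setoid = record { isEquivalence = ≈-isEquivalence }

  open IsEquivalence ≈-isEquivalence public
    using () renaming (refl to ≈-refl; sym to ≈-sym; trans to ≈-trans; reflexive to ≈-reflexive)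

  module ≈-Reasoning = SetoidReasoning ≈-setoid

  +-cong : ∀ {x x′ y y′} → x ≈ x′ → y ≈ y′ → x + y ≈ x′ + y′
  +-cong {x} {x′} {y} {y′} (mk≈ x≈x′) (mk≈ y≈y′) = mk≈ (begin
    (x + y) % d                ≡⟨ %-distribˡ-+ x y d ⟩
    (x % d + y % d) % d        ≡⟨ cong₂ (λ p q → (p + q) % d) x≈x′ y≈y′ ⟩
    (x′ % d + y′ % d) % d      ≡⟨ %-distribˡ-+ x′ y′ d ⟨
    (x′ + y′) % d              ∎)
    where open ≡-Reasoning

  *-cong : ∀ {x x′ y y′} → x ≈ x′ → y ≈ y′ → x * y ≈ x′ * y′
  *-cong {x} {x′} {y} {y′} (mk≈ x≈x′) (mk≈ y≈y′) = mk≈ (begin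
    (x * y) % d                ≡⟨ %-distribˡ-* x y d ⟩
    (x % d * (y % d)) % d      ≡⟨ cong₂ (λ p q → (p * q) % d) x≈x′ y≈y′ ⟩
    (x′ % d * (y′ % d)) % d    ≡⟨ %-distribˡ-* x′ y′ d ⟨
    (x′ * y′) % d              ∎)
    where open ≡-Reasoning

  x%d≈x : ∀ x → x % d ≈ x
  x%d≈x x = mk≈ (m%n%n≡m%n x d)

  x+kd≈x : ∀ x k → x + k * d ≈ x
  x+kd≈x x k = mk≈ ([m+kn]%n≡m%n x k d)

  +-cancelˡ : ∀ m {x y} → m + x ≈ m + y → x ≈ y
  +-cancelˡ m {x} {y} m+x≈m+y = begin
    x                ≈⟨ x+kd≈x x m ⟨
    x + m * d        ≡⟨ shift x ⟩
    (m + x) + m′     ≈⟨ +-cong m+x≈m+y ≈-refl ⟩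
    (m + y) + m′     ≡⟨ shift y ⟨
    y + m * d        ≈⟨ x+kd≈x y m ⟩
    y                ∎
    where
    open ≈-Reasoning
    -- m′ is an additive inverse of m modulo d
    m′ : ℕ
    m′ = m * d ∸ m
    shift : ∀ z → z + m * d ≡ (m + z) + m′
    shift z = trans (cong (z +_) (sym (m+[n∸m]≡n (m≤m*n m d))))
                    (trans (x∙yz≈y∙xz z m m′) (sym (+-assoc m z m′)))

  ≈⇒≡ : ∀ {x y} → x < d → y < d → x ≈ y → x ≡ y
  ≈⇒≡ x<d y<d (mk≈ x≈y) = trans (sym (m<n⇒m%n≡m x<d)) (trans x≈y (m<n⇒m%n≡m y<d))

  toℕ-≈-injective : ∀ {x y : Fin d} → toℕ x ≈ toℕ y → x ≡ y
  toℕ-≈-injective {x} {y} x≈y = toℕ-injective (≈⇒≡ (toℕ<n x) (toℕ<n y) x≈y)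

-- Deals

module _ {n a b c : ℕ} {A B C : Subset n} where

  open ≡-Reasoning

  deal-swap : IsDeal a b c A B C → IsDeal b a c B A C
  deal-swap (A#B , A#C , B#C , ∣A∣ , ∣B∣ , ∣C∣) = Disjoint-sym A#B , B#C , A#C , ∣B∣ , ∣A∣ , ∣C∣

  deal-∪≡⊤ : IsDeal a b c A B C → a + b + c ≡ n → A ∪ B ∪ C ≡ ⊤
  deal-∪≡⊤ (A#B , A#C , B#C , ∣A∣≡a , ∣B∣≡b , ∣C∣≡c) a+b+c≡n = ∣p∣≡n⇒p≡⊤ (begin
    ∣ A ∪ B ∪ C ∣               ≡⟨ ∣p∪q∣≡∣p∣+∣q∣ (Disjoint-∪ A#B A#C) ⟩
    ∣ A ∣ + ∣ B ∪ C ∣           ≡⟨ cong (∣ A ∣ +_) (∣p∪q∣≡∣p∣+∣q∣ B#C) ⟩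
    ∣ A ∣ + (∣ B ∣ + ∣ C ∣)     ≡⟨ cong₂ _+_ ∣A∣≡a (cong₂ _+_ ∣B∣≡b ∣C∣≡c) ⟩
    a + (b + c)                 ≡⟨ +-assoc a b c ⟨
    a + b + c                   ≡⟨ a+b+c≡n ⟩
    n                           ∎)

  deal-cover : IsDeal a b c A B C → a + b + c ≡ n → ∀ x → x ∈ A ⊎ x ∈ B ⊎ x ∈ C
  deal-cover deal a+b+c≡n x with x∈p∪q⁻ A _ (subst (x ∈_) (sym (deal-∪≡⊤ deal a+b+c≡n)) ∈⊤)
  ... | inj₁ x∈A = inj₁ x∈A
  ... | inj₂ x∈B∪C = inj₂ (x∈p∪q⁻ B C x∈B∪C)

  deal-sumℕ : IsDeal a b c A B C → a + b + c ≡ n → sumℕ A + sumℕ B + sumℕ C ≡ sumℕ (⊤ {n})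
  deal-sumℕ deal@(A#B , A#C , B#C , _) a+b+c≡n = begin
    sumℕ A + sumℕ B + sumℕ C       ≡⟨ +-assoc (sumℕ A) _ _ ⟩
    sumℕ A + (sumℕ B + sumℕ C)     ≡⟨ cong (sumℕ A +_) (sumFrom-∪ 0 B#C) ⟨
    sumℕ A + sumℕ (B ∪ C)          ≡⟨ sumFrom-∪ 0 (Disjoint-∪ A#B A#C) ⟨
    sumℕ (A ∪ B ∪ C)               ≡⟨ cong sumℕ (deal-∪≡⊤ deal a+b+c≡n) ⟩
    sumℕ (⊤ {n})                   ∎

∁-deal : ∀ {n a b c} {A C : Subset n} → Disjoint A C → ∣ A ∣ ≡ a → ∣ C ∣ ≡ c → a + b + c ≡ n →
         IsDeal a b c A (∁ (A ∪ C)) C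
∁-deal {n} {a} {b} {c} {A} {C} A#C ∣A∣≡a ∣C∣≡c a+b+c≡n =
  (λ x x∈A x∈B → x∈∁p⇒x∉p x∈B (x∈p∪q⁺ (inj₁ x∈A))) , A#C ,
  (λ x x∈B x∈C → x∈∁p⇒x∉p x∈B (x∈p∪q⁺ (inj₂ x∈C))) , ∣A∣≡a , ∣B∣≡b , ∣C∣≡c
  where
  open ≡-Reasoning
  ∣B∣≡b : ∣ ∁ (A ∪ C) ∣ ≡ b
  ∣B∣≡b = begin
    ∣ ∁ (A ∪ C) ∣         ≡⟨ ∣∁p∣≡n∸∣p∣ (A ∪ C) ⟩
    n ∸ ∣ A ∪ C ∣         ≡⟨ cong₂ _∸_ (sym a+b+c≡n) (trans (∣p∪q∣≡∣p∣+∣q∣ A#C) (cong₂ _+_ ∣A∣≡a ∣C∣≡c)) ⟩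
    a + b + c ∸ (a + c)   ≡⟨ cong (_∸ (a + c)) (xy∙z≈xz∙y a b c) ⟩
    a + c + b ∸ (a + c)   ≡⟨ m+n∸m≡n (a + c) b ⟩
    b                     ∎

module _ {n : ℕ} .{{_ : NonZero n}} where

  open Congruence n

  same-Σd-Bob : ∀ {a b c} {A B A′ B′ C : Subset n} → a + b + c ≡ n →
           IsDeal a b c A B C → IsDeal a b c A′ B′ C → Σd A′ ≡ Σd A → Σd B′ ≡ Σd B
  same-Σd-Bob {A = A} {B} {A′} {B′} {C} a+b+c≡n deal deal′ ΣA′≡ΣA =
    %≡% (+-cancelˡ (sumℕ A) (begin
      sumℕ A + sumℕ B′       ≈⟨ +-cong (mk≈ ΣA′≡ΣA) ≈-refl ⟨
      sumℕ A′ + sumℕ B′      ≡⟨ +-cancelʳ-≡ (sumℕ C) _ _ same-total ⟩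
      sumℕ A + sumℕ B        ∎))
    where
    open ≈-Reasoning
    same-total : sumℕ A′ + sumℕ B′ + sumℕ C ≡ sumℕ A + sumℕ B + sumℕ C
    same-total = trans (deal-sumℕ deal′ a+b+c≡n) (sym (deal-sumℕ deal a+b+c≡n))

  -- Announcing Σd A also tells Cath Σd B, so the roles of Alice and Bob are interchangeable.
  secure-swap : ∀ {a b c} → a + b + c ≡ n →
                SumAnnouncementSecure n a b c → SumAnnouncementSecure n b a c
  secure-swap a+b+c≡n secure B A C deal z z∉C with secure A B C (deal-swap deal) z z∉C
  ... | (A′ , B′ , deal′ , ΣA′≡ΣA , z∉A′) , (A″ , B″ , deal″ , ΣA″≡ΣA , z∉B″) =
    (B″ , A″ , deal-swap deal″ , same-Σd-Bob a+b+c≡n (deal-swap deal) deal″ ΣA″≡ΣA , z∉B″) ,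
    (B′ , A′ , deal-swap deal′ , same-Σd-Bob a+b+c≡n (deal-swap deal) deal′ ΣA′≡ΣA , z∉A′)

-- Announcements revealing a card

module _ (b : ℕ) where

  private
    one : Fin (2 + b)
    one = suc zero

    A C : Subset (2 + b)
    A = ⁅ one ⁆
    C = ⁅ zero ⁆

    deal : IsDeal 1 b 1 A (∁ (A ∪ C)) C
    deal = ∁-deal A#C (∣⁅x⁆∣≡1 one) (∣⁅x⁆∣≡1 {n = 2 + b} zero) (+-comm (1 + b) 1)
      where
      A#C : Disjoint A C
      A#C = ∉⇒Disjoint-⁅⁆ (x≢y⇒x∉⁅y⁆ {x = zero} {y = one} λ ())

    one∉C : one ∉ C
    one∉C = x≢y⇒x∉⁅y⁆ {y = zero} λ ()

  Alice-holds-one : ∀ {A′ B′} → IsDeal 1 b 1 A′ B′ C → Σd A′ ≡ Σd A → one ∈ A′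
  Alice-holds-one {A′} (_ , _ , _ , ∣A′∣≡1 , _) ΣA′≡ΣA =
    let y , A′≡⁅y⁆ = ∣p∣≡1⇒p≡⁅x⁆ A′ ∣A′∣≡1
        y≡one : y ≡ one
        y≡one = toℕ-≈-injective (begin
          toℕ y       ≡⟨ trans (cong sumℕ A′≡⁅y⁆) (sumℕ-⁅⁆ y) ⟨
          sumℕ A′     ≈⟨ mk≈ ΣA′≡ΣA ⟩
          sumℕ A      ≡⟨ sumℕ-⁅⁆ one ⟩
          1           ∎)
    in subst (one ∈_) (sym A′≡⁅y⁆) (subst (_∈ ⁅ y ⁆) y≡one (x∈⁅x⁆ y))
    where
    open Congruence (2 + b)
    open ≈-Reasoning

  insecure-a≡1 : ¬ SumAnnouncementSecure (2 + b) 1 b 1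
  insecure-a≡1 secure =
    let _ , _ , deal′ , ΣA′≡ΣA , one∉A′ = proj₁ (secure A (∁ (A ∪ C)) C deal one one∉C)
    in one∉A′ (Alice-holds-one deal′ ΣA′≡ΣA)

module _ (b : ℕ) where

  private
    three : Fin (4 + b)
    three = suc (suc (suc zero))

    hand : List (Fin (4 + b))
    hand = suc zero ∷ suc (suc zero) ∷ []

    hand! : Unique hand
    hand! = ((λ ()) ∷ []) ∷ [] ∷ []

    A C : Subset (4 + b)
    A = fromList hand
    C = ⁅ zero ⁆

    total : 2 + suc b + 1 ≡ 4 + b
    total = +-comm (2 + suc b) 1

    deal : IsDeal 2 (suc b) 1 A (∁ (A ∪ C)) C
    deal = ∁-deal (∉⇒Disjoint-⁅⁆ zero∉A) (∣fromList∣ hand!) (∣⁅x⁆∣≡1 {n = 4 + b} zero) total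
      where
      zero∉A : zero ∉ A
      zero∉A zero∈A with ∈-fromList⁻ hand zero∈A
      ... | Any.there (Any.there ())

    three∉C : three ∉ C
    three∉C = x≢y⇒x∉⁅y⁆ {y = zero} λ ()

  Bob-holds-three : ∀ {A″ B″} → IsDeal 2 (suc b) 1 A″ B″ C → Σd A″ ≡ Σd A → three ∈ B″
  Bob-holds-three {A″} deal″@(_ , A″#C , _ , ∣A″∣≡2 , _) ΣA″≡ΣA with deal-cover deal″ total three
  ... | inj₂ (inj₁ three∈B″) = three∈B″
  ... | inj₂ (inj₂ three∈C) = contradiction three∈C three∉C
  ... | inj₁ three∈A″ =
    let y , y∈A″ , ΣA″≡3+y = ∣p∣≡2⇒sumℕ-pair ∣A″∣≡2 three∈A″
        y≡zero : y ≡ zero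
        y≡zero = toℕ-≈-injective (+-cancelˡ 3 (begin
          3 + toℕ y       ≡⟨ ΣA″≡3+y ⟨
          sumℕ A″         ≈⟨ mk≈ ΣA″≡ΣA ⟩
          sumℕ A          ≡⟨ sumℕ-fromList hand! ⟩
          3               ∎))
    in ⊥-elim (A″#C y y∈A″ (subst (_∈ C) (sym y≡zero) (x∈⁅x⁆ zero)))
    where
    open Congruence (4 + b)
    open ≈-Reasoning

  insecure-a≡2 : ¬ SumAnnouncementSecure (4 + b) 2 (suc b) 1
  insecure-a≡2 secure =
    let _ , _ , deal″ , ΣA″≡ΣA , three∉B″ = proj₂ (secure A (∁ (A ∪ C)) C deal three three∉C)
    in three∉B″ (Bob-holds-three deal″ ΣA″≡ΣA)

-- Sums of windows

-- window x m e lists x, …, x + m − 1 and then x + m + 1, …, x + m + e: the run of m + e integers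
-- from x with its last e entries shifted up by one, so its sum exceeds the run's by e.
window : ℕ → ℕ → ℕ → List ℕ
window x zero e = iterate suc (suc x) e
window x (suc m) e = x ∷ window (suc x) m e

sum-iterate-+ : ∀ q x n → sum (iterate suc (q + x) n) ≡ q * n + sum (iterate suc x n)
sum-iterate-+ q x zero = sym (cong (_+ 0) (*-zeroʳ q))
sum-iterate-+ q x (suc n) = begin
  q + x + sum (iterate suc (suc (q + x)) n)      ≡⟨ cong (λ y → q + x + sum (iterate suc y n)) (+-suc q x) ⟨
  q + x + sum (iterate suc (q + suc x) n)        ≡⟨ cong (q + x +_) (sum-iterate-+ q (suc x) n) ⟩
  q + x + (q * n + sum (iterate suc (suc x) n))  ≡⟨ rearrange q x n (sum (iterate suc (suc x) n)) ⟩
  q * suc n + (x + sum (iterate suc (suc x) n))  ∎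
  where
  open ≡-Reasoning
  rearrange : ∀ q x n s → q + x + (q * n + s) ≡ q * (1 + n) + (x + s)
  rearrange = solve-∀

length-window : ∀ x m e → length (window x m e) ≡ m + e
length-window x zero e = length-iterate suc (suc x) e
length-window x (suc m) e = cong suc (length-window (suc x) m e)

sum-window : ∀ x m e → sum (window x m e) ≡ e + sum (iterate suc x (m + e))
sum-window x zero e = trans (sum-iterate-+ 1 x e) (cong (_+ sum (iterate suc x e)) (+-identityʳ e))
sum-window x (suc m) e = trans (cong (x +_) (sum-window (suc x) m e)) (x∙yz≈y∙xz x e _)

iterate-lower : ∀ x n → All (x ≤_) (iterate suc x n)
iterate-lower x zero = []
iterate-lower x (suc n) = ≤-refl ∷ All.map <⇒≤ (iterate-lower (suc x) n)

iterate-upper : ∀ x n → All (_< x + n) (iterate suc x n)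
iterate-upper x zero = []
iterate-upper x (suc n) =
  m<m+n x z<s ∷ subst (λ k → All (_< k) (iterate suc (suc x) n)) (sym (+-suc x n)) (iterate-upper (suc x) n)

iterate-sorted : ∀ x n → AllPairs _<_ (iterate suc x n)
iterate-sorted x zero = []
iterate-sorted x (suc n) = iterate-lower (suc x) n ∷ iterate-sorted (suc x) n

window-lower : ∀ x m e → All (x ≤_) (window x m e)
window-lower x zero e = All.map <⇒≤ (iterate-lower (suc x) e)
window-lower x (suc m) e = ≤-refl ∷ All.map <⇒≤ (window-lower (suc x) m e)

window-upper : ∀ x m e → All (_≤ x + (m + e)) (window x m e)
window-upper x zero e = All.map s≤s⁻¹ (iterate-upper (suc x) e)
window-upper x (suc m) e =
  m≤m+n x _ ∷ subst (λ k → All (_≤ k) (window (suc x) m e)) (sym (+-suc x (m + e))) (window-upper (suc x) m e)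

window-sorted : ∀ x m e → AllPairs _<_ (window x m e)
window-sorted x zero e = iterate-sorted (suc x) e
window-sorted x (suc m) e = window-lower (suc x) m e ∷ window-sorted (suc x) m e

bounded-divMod : ∀ j Q n → n ≤ Q * j + j → ∃[ q ] ∃[ m ] ∃[ e ] q ≤ Q × m + e ≡ j × n ≡ q * j + e
bounded-divMod j Q n n≤ with n ≤? j
... | yes n≤j = 0 , j ∸ n , n , z≤n , m∸n+n≡m n≤j , refl
bounded-divMod j zero n n≤ | no n≰j = contradiction n≤ n≰j
bounded-divMod j (suc Q) n n≤ | no n≰j with bounded-divMod j Q (n ∸ j) n∸j≤
  where
  n∸j≤ : n ∸ j ≤ Q * j + j
  n∸j≤ = ≤-trans (∸-monoˡ-≤ j n≤) (≤-reflexive (trans (m+n∸n≡m (j + Q * j) j) (+-comm j (Q * j))))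
... | q , m , e , q≤Q , m+e≡j , n∸j≡ = suc q , m , e , s≤s q≤Q , m+e≡j , (begin
  n                  ≡⟨ m+[n∸m]≡n (≰⇒≥ n≰j) ⟨
  j + (n ∸ j)        ≡⟨ cong (j +_) n∸j≡ ⟩
  j + (q * j + e)    ≡⟨ +-assoc j (q * j) e ⟨
  suc q * j + e      ∎)
  where open ≡-Reasoning

window-sums : ∀ lo j Q n → n ≤ Q * j + j →
              ∃[ W ] length W ≡ j × AllPairs _<_ W × All (lo ≤_) W × All (_≤ Q + lo + j) W ×
                     sum W ≡ n + sum (iterate suc lo j)
window-sums lo j Q n n≤ with bounded-divMod j Q n n≤
... | q , m , e , q≤Q , refl , refl =
  window (q + lo) m e , length-window (q + lo) m e , window-sorted (q + lo) m e ,
  All.map (≤-trans (m≤n+m lo q)) (window-lower (q + lo) m e) ,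
  All.map (λ w≤ → ≤-trans w≤ (+-monoˡ-≤ (m + e) (+-monoˡ-≤ lo q≤Q))) (window-upper (q + lo) m e) ,
  (begin
    sum (window (q + lo) m e)                            ≡⟨ sum-window (q + lo) m e ⟩
    e + sum (iterate suc (q + lo) (m + e))               ≡⟨ cong (e +_) (sum-iterate-+ q lo (m + e)) ⟩
    e + (q * (m + e) + sum (iterate suc lo (m + e)))     ≡⟨ x∙yz≈yx∙z e (q * (m + e)) _ ⟩
    q * (m + e) + e + sum (iterate suc lo (m + e))       ∎)
  where open ≡-Reasoning

module _ (n j Q t : ℕ) where

  open Congruence (suc n)

  -- K is the least sum of j distinct numbers from 2 on; windows of sum r + K then hit t modulo suc n.
  private
    K r : ℕ
    K = sum (iterate suc 2 j)
    r = (t + n * K) % suc n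

  window-residues : Q + 2 + j ≤ n → n ≤ Q * j + j →
                    ∃[ W ] length W ≡ j × AllPairs _<_ W × All (2 ≤_) W × All (_< suc n) W × sum W ≈ t
  window-residues Q+2+j≤n n≤ with window-sums 2 j Q r (≤-trans (s≤s⁻¹ (m%n<n (t + n * K) (suc n))) n≤)
  ... | W , ∣W∣≡j , W-sorted , 2≤W , W≤ , ΣW≡r+K =
    W , ∣W∣≡j , W-sorted , 2≤W , All.map (λ w≤ → s≤s (≤-trans w≤ Q+2+j≤n)) W≤ , (begin
      sum W                  ≡⟨ ΣW≡r+K ⟩
      r + K                  ≈⟨ +-cong (x%d≈x (t + n * K)) ≈-refl ⟩
      t + n * K + K          ≡⟨ rearrange t n K ⟩
      t + K * suc n          ≈⟨ x+kd≈x t K ⟩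
      t                      ∎)
    where
    open ≈-Reasoning
    rearrange : ∀ t n K → t + n * K + K ≡ t + K * (1 + n)
    rearrange = solve-∀

-- Affine maps modulo a prime

Unique-map⁺ : ∀ {A B : Set} {P : A → Set} {f : A → B} →
              (∀ {x y} → P x → P y → f x ≡ f y → x ≡ y) →
              ∀ {xs} → All P xs → Unique xs → Unique (map f xs)
Unique-map⁺ f-inj [] [] = []
Unique-map⁺ f-inj (px ∷ pxs) (x≢xs ∷ xs!) =
  All.map⁺ (All.zipWith (λ (py , x≢y) fx≡fy → x≢y (f-inj px py fx≡fy)) (pxs , x≢xs)) ∷
  Unique-map⁺ f-inj pxs xs!

module _ {n : ℕ} (isPrime : Prime (suc n)) where

  private
    d : ℕ
    d = suc n

  open Congruence d

  private
    1<d : 1 < d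
    1<d = nonTrivial⇒n>1 d {{prime⇒nonTrivial isPrime}}

  inverse : ∀ u → u % d ≢ 0 → ∃[ v ] u * v ≈ 1
  inverse u u≢0 with coprime-Bézout (prime⇒coprime isPrime {{≢-nonZero u≢0}} (m%n<n u d))
  ... | Bézout.-+ x y eq = y , (begin
    u * y                    ≈⟨ *-cong (x%d≈x u) ≈-refl ⟨
    r * y                    ≡⟨ trans (*-comm r y) (sym eq) ⟩
    1 + x * d                ≈⟨ x+kd≈x 1 x ⟩
    1                        ∎)
    where
    open ≈-Reasoning
    r : ℕ
    r = u % d
  ... | Bézout.+- x y eq = y * n , (begin
    u * (y * n)              ≈⟨ *-cong (x%d≈x u) ≈-refl ⟨
    r * (y * n)              ≈⟨ x+kd≈x _ x ⟨
    r * (y * n) + x * d      ≡⟨ cong (r * (y * n) +_) eq ⟨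
    r * (y * n) + (1 + y * r) ≡⟨ identity r y n ⟩
    1 + r * y * d            ≈⟨ x+kd≈x 1 (r * y) ⟩
    1                        ∎)
    where
    open ≈-Reasoning
    r : ℕ
    r = u % d
    identity : ∀ r y n → r * (y * n) + (1 + y * r) ≡ 1 + r * y * (1 + n)
    identity = solve-∀

  module Affine (c u v : ℕ) (uv≈1 : u * v ≈ 1) where

    F : ℕ → Fin d
    F i = (c + u * i) mod d

    toℕ-F : ∀ i → toℕ (F i) ≈ c + u * i
    toℕ-F i = ≈-trans (≈-reflexive (toℕ-fromℕ< _)) (x%d≈x (c + u * i))

    F-injective : ∀ {i j} → i < d → j < d → F i ≡ F j → i ≡ j
    F-injective {i} {j} i<d j<d Fi≡Fj = ≈⇒≡ i<d j<d (begin
      i                  ≡⟨ *-identityˡ i ⟨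
      1 * i              ≈⟨ *-cong uv≈1 ≈-refl ⟨
      u * v * i          ≡⟨ rearrange u v i ⟩
      v * (u * i)        ≈⟨ *-cong (≈-refl {v}) ui≈uj ⟩
      v * (u * j)        ≡⟨ rearrange u v j ⟨
      u * v * j          ≈⟨ *-cong uv≈1 ≈-refl ⟩
      1 * j              ≡⟨ *-identityˡ j ⟩
      j                  ∎)
      where
      open ≈-Reasoning
      ui≈uj : u * i ≈ u * j
      ui≈uj = +-cancelˡ c (≈-trans (≈-sym (toℕ-F i)) (≈-trans (≈-reflexive (cong toℕ Fi≡Fj)) (toℕ-F j)))
      rearrange : ∀ u v i → u * v * i ≡ v * (u * i)
      rearrange = solve-∀

    solve : ∀ m s → ∃[ t ] u * t + m ≈ s
    solve m s = v * (s + n * m) , (begin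
      u * (v * (s + n * m)) + m    ≡⟨ rearrange u v (s + n * m) m ⟩
      u * v * (s + n * m) + m      ≈⟨ +-cong (*-cong uv≈1 ≈-refl) ≈-refl ⟩
      1 * (s + n * m) + m          ≡⟨ rearrange′ s n m ⟩
      s + m * d                    ≈⟨ x+kd≈x s m ⟩
      s                            ∎)
      where
      open ≈-Reasoning
      rearrange : ∀ u v k m → u * (v * k) + m ≡ u * v * k + m
      rearrange = solve-∀
      rearrange′ : ∀ s n m → 1 * (s + n * m) + m ≡ s + m * (1 + n)
      rearrange′ = solve-∀

    Unique-map-F : ∀ {L} → All (_< d) L → AllPairs _<_ L → Unique (map F L)
    Unique-map-F L<d L-sorted = Unique-map⁺ F-injective L<d (AllPairs.map <⇒≢ L-sorted)

    sum-map-F : ∀ L → sum (map toℕ (map F L)) ≈ length L * c + u * sum L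
    sum-map-F [] = ≈-reflexive (sym (*-zeroʳ u))
    sum-map-F (i ∷ L) =
      ≈-trans (+-cong (toℕ-F i) (sum-map-F L)) (≈-reflexive (rearrange c u i (length L) (sum L)))
      where
      rearrange : ∀ c u i l s → c + u * i + (l * c + u * s) ≡ (1 + l) * c + u * (i + s)
      rearrange = solve-∀

    -- Abstract, so that the type checker never unfolds the modular arithmetic of F inside a hand.
    abstract
      image : List ℕ → Subset d
      image L = fromList (map F L)

      ∣image∣ : ∀ {L} → All (_< d) L → AllPairs _<_ L → ∣ image L ∣ ≡ length L
      ∣image∣ {L} L<d L-sorted = trans (∣fromList∣ (Unique-map-F L<d L-sorted)) (length-map F L)

      sumℕ-image : ∀ {L} → All (_< d) L → AllPairs _<_ L → sumℕ (image L) ≈ length L * c + u * sum L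
      sumℕ-image {L} L<d L-sorted =
        ≈-trans (≈-reflexive (sumℕ-fromList (Unique-map-F L<d L-sorted))) (sum-map-F L)

      F∈image-head : ∀ i L → F i ∈ image (i ∷ L)
      F∈image-head i L = x∈p∪q⁺ (inj₁ (x∈⁅x⁆ (F i)))

      F∉image : ∀ {i L} → i < d → All (_< d) L → All (i <_) L → F i ∉ image L
      F∉image {L = L} i<d L<d i<L Fi∈ with ∈-map⁻ F (∈-fromList⁻ (map F L) Fi∈)
      ... | k , k∈L , Fi≡Fk = <-irrefl (F-injective i<d (All.lookup L<d k∈L) Fi≡Fk) (All.lookup i<L k∈L)

  module _ (c0 z : Fin d) (z≢c0 : z ≢ c0) where

    private
      c u : ℕ
      c = toℕ c0
      -- u is z - c0 modulo d, so the affine map i ↦ c0 + u i sends 0 to c0 and 1 to z.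
      u = toℕ z + (d ∸ c)

      c+u≈z : c + u ≈ toℕ z
      c+u≈z = ≈-trans (≈-reflexive (begin
        c + (toℕ z + (d ∸ c))    ≡⟨ x∙yz≈y∙xz c (toℕ z) (d ∸ c) ⟩
        toℕ z + (c + (d ∸ c))    ≡⟨ cong (toℕ z +_) (m+[n∸m]≡n (<⇒≤ (toℕ<n c0))) ⟩
        toℕ z + d                ≡⟨ cong (toℕ z +_) (+-identityʳ d) ⟨
        toℕ z + 1 * d            ∎)) (x+kd≈x (toℕ z) 1)
        where open ≡-Reasoning

      u%d≢0 : u % d ≢ 0
      u%d≢0 u%d≡0 = z≢c0 (toℕ-≈-injective (begin
        toℕ z      ≈⟨ c+u≈z ⟨
        c + u      ≈⟨ +-cong (≈-refl {c}) (mk≈ {u} {0} u%d≡0) ⟩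
        c + 0      ≡⟨ +-identityʳ c ⟩
        c          ∎))
        where open ≈-Reasoning

      v : ℕ
      v = proj₁ (inverse u u%d≢0)

    open Affine c u v (proj₂ (inverse u u%d≢0))

    private
      F0≡c0 : F 0 ≡ c0
      F0≡c0 = toℕ-≈-injective (≈-trans (toℕ-F 0) (≈-reflexive (trans (cong (c +_) (*-zeroʳ u)) (+-identityʳ c))))

      F1≡z : F 1 ≡ z
      F1≡z = toℕ-≈-injective (≈-trans (toℕ-F 1) (≈-trans (≈-reflexive (cong (c +_) (*-identityʳ u))) c+u≈z))

      c0∉image : ∀ {L} → All (_< d) L → All (1 ≤_) L → c0 ∉ image L
      c0∉image {L} L<d 1≤L = subst (_∉ image L) F0≡c0 (F∉image (s≤s z≤n) L<d 1≤L)

    hand-without-z : ∀ j Q → Q + 2 + j ≤ n → n ≤ Q * j + j → ∀ s →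
                    ∃[ X ] ∣ X ∣ ≡ j × sumℕ X ≈ s × c0 ∉ X × z ∉ X
    hand-without-z j Q Q+2+j≤n n≤ s =
      let t , ut+jc≈s = solve (j * c) s
          W , ∣W∣≡j , W-sorted , 2≤W , W<d , ΣW≈t = window-residues n j Q t Q+2+j≤n n≤
          ΣX≈s : sumℕ (image W) ≈ s
          ΣX≈s = begin
            sumℕ (image W)                  ≈⟨ sumℕ-image W<d W-sorted ⟩
            length W * c + u * sum W        ≈⟨ +-cong (≈-refl {length W * c}) (*-cong (≈-refl {u}) ΣW≈t) ⟩
            length W * c + u * t            ≡⟨ cong (λ l → l * c + u * t) ∣W∣≡j ⟩
            j * c + u * t                   ≡⟨ +-comm (j * c) (u * t) ⟩
            u * t + j * c                   ≈⟨ ut+jc≈s ⟩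
            s                               ∎
      in image W , trans (∣image∣ W<d W-sorted) ∣W∣≡j , ΣX≈s ,
         c0∉image W<d (All.map <⇒≤ 2≤W) ,
         subst (_∉ image W) F1≡z (F∉image 1<d W<d 2≤W)
      where open ≈-Reasoning

    hand-with-z : ∀ j Q → Q + 2 + j ≤ n → n ≤ Q * j + j → ∀ s →
                   ∃[ X ] ∣ X ∣ ≡ suc j × sumℕ X ≈ s × c0 ∉ X × z ∈ X
    hand-with-z j Q Q+2+j≤n n≤ s =
      let t , ut+≈s = solve (suc j * c + u) s
          W , ∣W∣≡j , W-sorted , 2≤W , W<d , ΣW≈t = window-residues n j Q t Q+2+j≤n n≤
          L : List ℕ
          L = 1 ∷ W
          L<d : All (_< d) L
          L<d = 1<d ∷ W<d
          L-sorted : AllPairs _<_ L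
          L-sorted = 2≤W ∷ W-sorted
          ΣX≈s : sumℕ (image L) ≈ s
          ΣX≈s = begin
            sumℕ (image L)                          ≈⟨ sumℕ-image L<d L-sorted ⟩
            suc (length W) * c + u * (1 + sum W)    ≈⟨ +-cong (≈-refl {suc (length W) * c})
                                                              (*-cong (≈-refl {u}) (+-cong (≈-refl {1}) ΣW≈t)) ⟩
            suc (length W) * c + u * (1 + t)        ≡⟨ cong (λ l → suc l * c + u * (1 + t)) ∣W∣≡j ⟩
            suc j * c + u * (1 + t)                 ≡⟨ rearrange j c u t ⟩
            u * t + (suc j * c + u)                 ≈⟨ ut+≈s ⟩
            s                                       ∎
      in image L , trans (∣image∣ L<d L-sorted) (cong suc ∣W∣≡j) , ΣX≈s ,
         c0∉image L<d (≤-refl ∷ All.map <⇒≤ 2≤W) ,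
         subst (_∈ image L) F1≡z (F∈image-head 1 W)
      where
      open ≈-Reasoning
      rearrange : ∀ l c u t → (1 + l) * c + u * (1 + t) ≡ u * t + ((1 + l) * c + u)
      rearrange = solve-∀

secure⇒2<a : ∀ a b → 1 ≤ a → 1 ≤ b → SumAnnouncementSecure (suc (a + b)) a b 1 → 2 < a
secure⇒2<a 1 b _ _ secure = ⊥-elim (insecure-a≡1 b secure)
secure⇒2<a 2 (suc b) _ _ secure = ⊥-elim (insecure-a≡2 b secure)
secure⇒2<a (suc (suc (suc a))) b _ _ _ = s≤s (s≤s (s≤s z≤n))

2<a×2<b⇒secure : ∀ a b → Prime (suc (a + b)) → 2 < a → 2 < b → SumAnnouncementSecure (suc (a + b)) a b 1
2<a×2<b⇒secure a@(suc (suc (suc α))) b@(suc (suc (suc β))) isPrime (s≤s (s≤s (s≤s _))) (s≤s (s≤s (s≤s _)))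
               A B C (_ , _ , _ , _ , _ , ∣C∣≡1) z z∉C = Alice-avoids-z , Bob-avoids-z
  where
  c0 : Fin (suc (a + b))
  c0 = proj₁ (∣p∣≡1⇒p≡⁅x⁆ C ∣C∣≡1)

  C≡⁅c0⁆ : C ≡ ⁅ c0 ⁆
  C≡⁅c0⁆ = proj₂ (∣p∣≡1⇒p≡⁅x⁆ C ∣C∣≡1)

  z≢c0 : z ≢ c0
  z≢c0 z≡c0 = z∉C (subst (z ∈_) (sym C≡⁅c0⁆) (subst (_∈ ⁅ c0 ⁆) (sym z≡c0) (x∈⁅x⁆ c0)))

  deal-with : ∀ {X} → ∣ X ∣ ≡ a → c0 ∉ X → IsDeal a b 1 X (∁ (X ∪ C)) C
  deal-with ∣X∣≡a c0∉X =
    ∁-deal (subst (Disjoint _) (sym C≡⁅c0⁆) (∉⇒Disjoint-⁅⁆ c0∉X)) ∣X∣≡a ∣C∣≡1 (+-comm (a + b) 1)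

  fits₁ : suc β + 2 + a ≤ a + b
  fits₁ = ≤-reflexive (identity α β)
    where identity : ∀ α β → (1 + β) + 2 + (3 + α) ≡ (3 + α) + (3 + β)
          identity = solve-∀
  covers₁ : a + b ≤ suc β * a + a
  covers₁ = subst (a + b ≤_) (identity α β) (m≤m+n (a + b) _)
    where identity : ∀ α β → (3 + α) + (3 + β) + (α + 2 * β + α * β) ≡ (1 + β) * (3 + α) + (3 + α)
          identity = solve-∀
  fits₂ : suc (suc β) + 2 + suc (suc α) ≤ a + b
  fits₂ = ≤-reflexive (identity α β)
    where identity : ∀ α β → (2 + β) + 2 + (2 + α) ≡ (3 + α) + (3 + β)
          identity = solve-∀
  covers₂ : a + b ≤ suc (suc β) * suc (suc α) + suc (suc α)
  covers₂ = subst (a + b ≤_) (identity α β) (m≤m+n (a + b) _)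
    where identity : ∀ α β → (3 + α) + (3 + β) + (2 * α + β + α * β) ≡ (2 + β) * (2 + α) + (2 + α)
          identity = solve-∀

  Alice-avoids-z : ∃₂ λ A′ B′ → IsDeal a b 1 A′ B′ C × Σd A′ ≡ Σd A × z ∉ A′
  Alice-avoids-z =
    let X , ∣X∣≡a , ΣX≈ΣA , c0∉X , z∉X =
          hand-without-z isPrime c0 z z≢c0 a (suc β) fits₁ covers₁ (sumℕ A)
    in X , ∁ (X ∪ C) , deal-with ∣X∣≡a c0∉X , Congruence.%≡% ΣX≈ΣA , z∉X

  Bob-avoids-z : ∃₂ λ A″ B″ → IsDeal a b 1 A″ B″ C × Σd A″ ≡ Σd A × z ∉ B″
  Bob-avoids-z =
    let X , ∣X∣≡a , ΣX≈ΣA , c0∉X , z∈X =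
          hand-with-z isPrime c0 z z≢c0 (suc (suc α)) (suc (suc β)) fits₂ covers₂ (sumℕ A)
    in X , ∁ (X ∪ C) , deal-with ∣X∣≡a c0∉X , Congruence.%≡% ΣX≈ΣA , x∈p⇒x∉∁p (x∈p∪q⁺ (inj₁ z∈X))

mainTheorem6 : (a b : ℕ) → 1 ≤ a → 1 ≤ b → Prime (suc (a + b)) →
    SumAnnouncementSecure (suc (a + b)) a b 1 ⇔ (2 < a × 2 < b)
mainTheorem6 a b 1≤a 1≤b isPrime = mk⇔
  (λ secure → secure⇒2<a a b 1≤a 1≤b secure , secure⇒2<a b a 1≤b 1≤a (swap secure))
  (λ (2<a , 2<b) → 2<a×2<b⇒secure a b isPrime 2<a 2<b)
  where
  swap : SumAnnouncementSecure (suc (a + b)) a b 1 → SumAnnouncementSecure (suc (b + a)) b a 1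
  swap = subst (λ m → SumAnnouncementSecure (suc m) b a 1) (+-comm a b) ∘ secure-swap (+-comm (a + b) 1)
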